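{- For every integer $j\ge 1$ and all $x$, \[ U_{j}(x)=2^j\sum_{m=0}^{\left\lfloor j/2\right\rfloor}(-1)^{m+1}\binom{j}{m}\frac{ -j+2m-1}{j-m+1}\;{}_{2}F_{1}\!\left(\begin{matrix}-m,\ -j+m-1\\ -j\end{matrix}\,\Big|\,-\tfrac14\right)F_{j-2m+1}(x). \]
   Context: The Fibonacci polynomials are defined by $F_0(x)=0$, $F_1(x)=1$, $F_{n+2}(x)=xF_{n+1}(x)+F_n(x)$ for $n\ge 0$. $U_n(x)$ denotes the Chebyshev polynomial of the second kind, $U_n(\cos\theta)=\sin((n+1)\theta)/\sin\theta$ (equivalently $U_0=1$, $U_1=2x$, $U_n=2xU_{n-1}-U_{n-2}$). For a nonnegative integer $m$, the terminating hypergeometric series is ${}_2F_1\!\left(\begin{smallmatrix}-m,\ b\\ c\end{smallmatrix}\big|z\right)=\sum_{k=0}^{m}\frac{(-m)_k(b)_k}{(c)_k\,k!}z^k$ (here the denominators $(c)_k$ are nonzero), where $(a)_k=a(a+1)\cdots(a+k-1)$. -}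

module Defs where

open import Data.Nat as ℕ using (ℕ; zero; suc; _∸_)
open import Data.Nat.Combinatorics using (_C_)
open import Data.Nat.Base using (⌊_/2⌋)
open import Data.Integer as ℤ using (ℤ)
open import Data.Rational using (ℚ; 0ℚ; 1ℚ; _+_; _*_; _-_; -_; _÷_; _/_; ≢-nonZero)
open import Data.Rational.Properties using (_≟_)
open import Relation.Nullary using (yes; no)

ℕ→ℚ : ℕ → ℚ
ℕ→ℚ n = ℤ.+ n / 1

ℤ→ℚ : ℤ → ℚ
ℤ→ℚ z = z / 1

-- division; only ever applied (in the statement) to nonzero denominators.
-- By convention returns 0 on a zero denominator.
_÷'_ : ℚ → ℚ → ℚ
p ÷' q with q ≟ 0ℚ
... | yes _ = 0ℚ
... | no q≢0 = _÷_ p q {{≢-nonZero q≢0}}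

_^_ : ℚ → ℕ → ℚ
p ^ zero = 1ℚ
p ^ suc n = p * (p ^ n)

sumTo : ℕ → (ℕ → ℚ) → ℚ
sumTo zero f = f 0
sumTo (suc n) f = sumTo n f + f (suc n)

F : ℕ → ℚ → ℚ
F zero x = 0ℚ
F (suc zero) x = 1ℚ
F (suc (suc n)) x = x * F (suc n) x + F n x

U : ℕ → ℚ → ℚ
U zero x = 1ℚ
U (suc zero) x = ℕ→ℚ 2 * x
U (suc (suc n)) x = ℕ→ℚ 2 * x * U (suc n) x - U n x

poch : ℚ → ℕ → ℚ
poch a zero = 1ℚ
poch a (suc k) = poch a k * (a + ℕ→ℚ k)

fact : ℕ → ℚ
fact zero = 1ℚ
fact (suc k) = fact k * ℕ→ℚ (suc k)

hyp2F1 : ℕ → ℚ → ℚ → ℚ → ℚ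
hyp2F1 m b c z =
  sumTo m (λ k → ((poch (- ℕ→ℚ m) k * poch b k) ÷' (poch c k * fact k)) * (z ^ k))

sgn : ℕ → ℚ
sgn n = (- 1ℚ) ^ n

rhsTerm : ℕ → ℚ → ℕ → ℚ
rhsTerm j x m =
  sgn (suc m) * ℕ→ℚ (j C m)
  * ((- ℕ→ℚ j + ℕ→ℚ (2 ℕ.* m) - 1ℚ) ÷' (ℕ→ℚ j - ℕ→ℚ m + 1ℚ))
  * hyp2F1 m (- ℕ→ℚ j + ℕ→ℚ m - 1ℚ) (- ℕ→ℚ j) (- (1ℚ ÷' ℕ→ℚ 4))
  * F ((j ∸ (2 ℕ.* m)) ℕ.+ 1) x

{-# OPTIONS --safe #-}
-- Expand U_j in powers of 2x and every power of x in the Fibonacci basis: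
--   U_j = Σ_k (-1)^k C(j-k,k) (2x)^(j-2k),     x^n = Σ_i (-1)^i b(n,i) F_(n+1-2i),
-- with ballot numbers b(n,i) = C(n,i) - C(n,i-1); the first follows from the recurrence of U and
-- Pascal's rule, the second from x F_m = F_(m+1) - F_(m-1).  Collecting terms, the coefficient of
-- F_(j-2m+1) in U_j is Σ_{k≤m} (-1)^k C(j-k,k) 2^(j-2k) (-1)^(m-k) b(j-2k,m-k).  As (-m)_k, (-j+m-1)_k
-- and (-j)_k are signed ratios of factorials, the k-th summand is 2^j times the prefactor of the 2F1
-- times its k-th term.
module Submission where

open import Defs
open import Data.Nat using (ℕ; _≥_; ⌊_/2⌋)
open import Data.Rational using (ℚ; _*_)
open import Relation.Binary.PropositionalEquality using (_≡_)

open import Data.Empty using (⊥-elim)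
open import Data.Integer as ℤ using ()
import Data.Integer.Properties as ℤ
open import Data.Nat as ℕ using (zero; suc; _∸_; _≤_; _<_; z≤n; s≤s; _!)
open import Data.Nat.Combinatorics
  using (_C_; k>n⇒nCk≡0; nCk≡nC[n∸k]; nCk+nC[k+1]≡[n+1]C[k+1]; nCk≡n!/k![n-k]!; k![n∸k]!∣n!)
import Data.Nat.Coprimality as Coprime
open import Data.Nat.DivMod using (m/n*n≡m)
open import Data.Nat.Properties as ℕ
  using (≤-refl; ≤-trans; m≤n⇒m≤1+n; <⇒≤; <-cmp; +-∸-assoc; m+n∸m≡n; m+[n∸m]≡n; m≤n⇒m∸n≡0;
         _!≢0; _!*_!≢0)
import Data.Nat.Tactic.RingSolver as ℕ-Solver
open import Data.Rational using (0ℚ; 1ℚ; _+_; _-_; -_; _/_; 1/_; ≢-nonZero)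
open import Data.Rational.Properties using (+-*-commutativeRing; _≟_; normalize-coprime)
import Data.Rational.Properties as ℚ
open import Data.Sum using (inj₁; inj₂)
open import Level using (0ℓ)
open import Relation.Binary.Definitions using (tri<; tri≈; tri>)
open import Relation.Binary.PropositionalEquality
  using (refl; sym; trans; cong; cong₂; subst; _≢_; module ≡-Reasoning)
open import Relation.Nullary using (yes; no)
open import Relation.Nullary.Decidable.Core using (dec⇒maybe)
open import Tactic.RingSolver using (solve-∀)
import Tactic.RingSolver.Core.AlmostCommutativeRing as ACR

ℚ-ring : ACR.AlmostCommutativeRing 0ℓ 0ℓ
ℚ-ring = ACR.fromCommutativeRing +-*-commutativeRing (λ q → dec⇒maybe (0ℚ ≟ q))

ℕ→ℚ-suc : ∀ n → ℕ→ℚ (suc n) ≡ 1ℚ + ℕ→ℚ n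
ℕ→ℚ-suc n
  rewrite normalize-coprime {n} {0} (Coprime.sym (Coprime.1-coprimeTo n))
  = cong (_/ 1) (cong (ℤ._+_ (ℤ.+ 1)) (sym (ℤ.*-identityʳ (ℤ.+ n))))

ℕ→ℚ-+ : ∀ m n → ℕ→ℚ (m ℕ.+ n) ≡ ℕ→ℚ m + ℕ→ℚ n
ℕ→ℚ-+ zero    n = sym (ℚ.+-identityˡ (ℕ→ℚ n))
ℕ→ℚ-+ (suc m) n = begin
  ℕ→ℚ (suc (m ℕ.+ n))   ≡⟨ ℕ→ℚ-suc (m ℕ.+ n) ⟩
  1ℚ + ℕ→ℚ (m ℕ.+ n)    ≡⟨ cong (1ℚ +_) (ℕ→ℚ-+ m n) ⟩
  1ℚ + (ℕ→ℚ m + ℕ→ℚ n)  ≡⟨ ℚ.+-assoc 1ℚ (ℕ→ℚ m) (ℕ→ℚ n) ⟨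
  1ℚ + ℕ→ℚ m + ℕ→ℚ n    ≡⟨ cong (_+ ℕ→ℚ n) (ℕ→ℚ-suc m) ⟨
  ℕ→ℚ (suc m) + ℕ→ℚ n   ∎
  where open ≡-Reasoning

ℕ→ℚ-* : ∀ m n → ℕ→ℚ (m ℕ.* n) ≡ ℕ→ℚ m * ℕ→ℚ n
ℕ→ℚ-* zero    n = sym (ℚ.*-zeroˡ (ℕ→ℚ n))
ℕ→ℚ-* (suc m) n = begin
  ℕ→ℚ (n ℕ.+ m ℕ.* n)        ≡⟨ ℕ→ℚ-+ n (m ℕ.* n) ⟩
  ℕ→ℚ n + ℕ→ℚ (m ℕ.* n)      ≡⟨ cong (ℕ→ℚ n +_) (ℕ→ℚ-* m n) ⟩
  ℕ→ℚ n + ℕ→ℚ m * ℕ→ℚ n      ≡⟨ distrib (ℕ→ℚ m) (ℕ→ℚ n) ⟩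
  (1ℚ + ℕ→ℚ m) * ℕ→ℚ n       ≡⟨ cong (_* ℕ→ℚ n) (ℕ→ℚ-suc m) ⟨
  ℕ→ℚ (suc m) * ℕ→ℚ n        ∎
  where open ≡-Reasoning
        distrib : ∀ a b → b + a * b ≡ (1ℚ + a) * b
        distrib = solve-∀ ℚ-ring

ℕ→ℚ-≢0 : ∀ n .{{_ : ℕ.NonZero n}} → ℕ→ℚ n ≢ 0ℚ
ℕ→ℚ-≢0 (suc n) eq with trans (sym (normalize-coprime (Coprime.sym (Coprime.1-coprimeTo (suc n))))) eq
... | ()

÷'-inverse : ∀ p {q r} → q * r ≡ 1ℚ → p ÷' q ≡ p * r
÷'-inverse p {q} {r} qr≡1 with q ≟ 0ℚ
... | yes refl = ⊥-elim (ℚ.1≢0 (trans (sym qr≡1) (ℚ.*-zeroˡ r)))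
... | no q≢0 = cong (p *_) (begin
  1/ q              ≡⟨ ℚ.*-identityʳ (1/ q) ⟨
  1/ q * 1ℚ         ≡⟨ cong (1/ q *_) qr≡1 ⟨
  1/ q * (q * r)    ≡⟨ ℚ.*-assoc (1/ q) q r ⟨
  1/ q * q * r      ≡⟨ cong (_* r) (ℚ.*-inverseˡ q) ⟩
  1ℚ * r            ≡⟨ ℚ.*-identityˡ r ⟩
  r                 ∎)
  where open ≡-Reasoning
        instance _ = ≢-nonZero q≢0

*-÷'-inverse : ∀ {q} → q ≢ 0ℚ → q * (1ℚ ÷' q) ≡ 1ℚ
*-÷'-inverse {q} q≢0 with q ≟ 0ℚ
... | yes q≡0 = ⊥-elim (q≢0 q≡0)
... | no q≢0 = trans (cong (q *_) (ℚ.*-identityˡ (1/ q))) (ℚ.*-inverseʳ q)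
  where instance _ = ≢-nonZero q≢0

*-inverse-* : ∀ {a a′ b b′} → a * a′ ≡ 1ℚ → b * b′ ≡ 1ℚ → (a * b) * (a′ * b′) ≡ 1ℚ
*-inverse-* {a} {a′} {b} {b′} aa′≡1 bb′≡1 = begin
  (a * b) * (a′ * b′)    ≡⟨ interchange a b a′ b′ ⟩
  (a * a′) * (b * b′)    ≡⟨ cong₂ _*_ aa′≡1 bb′≡1 ⟩
  1ℚ                     ∎
  where open ≡-Reasoning
        interchange : ∀ a b a′ b′ → (a * b) * (a′ * b′) ≡ (a * a′) * (b * b′)
        interchange = solve-∀ ℚ-ring

^-+ : ∀ p a b → p ^ (a ℕ.+ b) ≡ p ^ a * p ^ b
^-+ p zero    b = sym (ℚ.*-identityˡ (p ^ b))
^-+ p (suc a) b = trans (cong (p *_) (^-+ p a b)) (sym (ℚ.*-assoc p (p ^ a) (p ^ b)))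

^-* : ∀ p q n → (p * q) ^ n ≡ p ^ n * q ^ n
^-* p q zero    = refl
^-* p q (suc n) = trans (cong ((p * q) *_) (^-* p q n)) (swap p q (p ^ n) (q ^ n))
  where swap : ∀ a b c d → a * b * (c * d) ≡ a * c * (b * d)
        swap = solve-∀ ℚ-ring

1^n≡1 : ∀ n → 1ℚ ^ n ≡ 1ℚ
1^n≡1 zero    = refl
1^n≡1 (suc n) = trans (ℚ.*-identityˡ (1ℚ ^ n)) (1^n≡1 n)

sgn-+ : ∀ a b → sgn (a ℕ.+ b) ≡ sgn a * sgn b
sgn-+ = ^-+ (- 1ℚ)

sgn*sgn : ∀ n → sgn n * sgn n ≡ 1ℚ
sgn*sgn n = trans (sym (^-* (- 1ℚ) (- 1ℚ) n)) (1^n≡1 n)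

neg-^ : ∀ p n → (- p) ^ n ≡ sgn n * p ^ n
neg-^ p n = trans (cong (_^ n) (neg≡-1* p)) (^-* (- 1ℚ) p n)
  where neg≡-1* : ∀ a → - a ≡ - 1ℚ * a
        neg≡-1* = solve-∀ ℚ-ring

sumTo-cong : ∀ n {f g : ℕ → ℚ} → (∀ k → k ≤ n → f k ≡ g k) → sumTo n f ≡ sumTo n g
sumTo-cong zero    f≗g = f≗g 0 z≤n
sumTo-cong (suc n) f≗g =
  cong₂ _+_ (sumTo-cong n (λ k k≤n → f≗g k (m≤n⇒m≤1+n k≤n))) (f≗g (suc n) ≤-refl)

sumTo-+ : ∀ n (f g : ℕ → ℚ) → sumTo n (λ k → f k + g k) ≡ sumTo n f + sumTo n g
sumTo-+ zero    f g = refl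
sumTo-+ (suc n) f g =
  trans (cong (_+ (f (suc n) + g (suc n))) (sumTo-+ n f g))
    (interchange (sumTo n f) (sumTo n g) (f (suc n)) (g (suc n)))
  where interchange : ∀ a b c d → a + b + (c + d) ≡ a + c + (b + d)
        interchange = solve-∀ ℚ-ring

sumTo-- : ∀ n (f g : ℕ → ℚ) → sumTo n (λ k → f k - g k) ≡ sumTo n f - sumTo n g
sumTo-- zero    f g = refl
sumTo-- (suc n) f g =
  trans (cong (_+ (f (suc n) - g (suc n))) (sumTo-- n f g))
    (interchange (sumTo n f) (sumTo n g) (f (suc n)) (g (suc n)))
  where interchange : ∀ a b c d → a - b + (c - d) ≡ a + c - (b + d)
        interchange = solve-∀ ℚ-ring

sumTo-0 : ∀ n → sumTo n (λ _ → 0ℚ) ≡ 0ℚ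
sumTo-0 zero    = refl
sumTo-0 (suc n) = cong (_+ 0ℚ) (sumTo-0 n)

*-distribˡ-sumTo : ∀ n a (f : ℕ → ℚ) → a * sumTo n f ≡ sumTo n (λ k → a * f k)
*-distribˡ-sumTo zero    a f = refl
*-distribˡ-sumTo (suc n) a f =
  trans (ℚ.*-distribˡ-+ a (sumTo n f) (f (suc n))) (cong (_+ a * f (suc n)) (*-distribˡ-sumTo n a f))

*-distribʳ-sumTo : ∀ n a (f : ℕ → ℚ) → sumTo n f * a ≡ sumTo n (λ k → f k * a)
*-distribʳ-sumTo zero    a f = refl
*-distribʳ-sumTo (suc n) a f =
  trans (ℚ.*-distribʳ-+ a (sumTo n f) (f (suc n))) (cong (_+ f (suc n) * a) (*-distribʳ-sumTo n a f))

sumTo-suc : ∀ n (f : ℕ → ℚ) → sumTo (suc n) f ≡ f 0 + sumTo n (λ k → f (suc k))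
sumTo-suc zero    f = refl
sumTo-suc (suc n) f =
  trans (cong (_+ f (suc (suc n))) (sumTo-suc n f)) (ℚ.+-assoc (f 0) _ (f (suc (suc n))))

sumTo-extend : ∀ {N} M {f : ℕ → ℚ} → (∀ k → N < k → f k ≡ 0ℚ) → N ≤ M → sumTo M f ≡ sumTo N f
sumTo-extend {N} M {f} f≡0 N≤M with ℕ.m≤n⇒m<n∨m≡n N≤M
sumTo-extend {N} (suc M) {f} f≡0 N≤M | inj₁ (s≤s N≤M') = begin
  sumTo M f + f (suc M)  ≡⟨ cong₂ _+_ (sumTo-extend M f≡0 N≤M') (f≡0 (suc M) (s≤s N≤M')) ⟩
  sumTo N f + 0ℚ         ≡⟨ ℚ.+-identityʳ (sumTo N f) ⟩
  sumTo N f              ∎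
  where open ≡-Reasoning
... | inj₂ refl = refl

sumTo-triangle : ∀ M (g : ℕ → ℕ → ℚ) →
  sumTo M (λ k → sumTo (M ∸ k) (λ i → g k (k ℕ.+ i))) ≡ sumTo M (λ m → sumTo m (λ k → g k m))
sumTo-triangle zero    g = refl
sumTo-triangle (suc M) g = begin
  sumTo M (λ k → sumTo (suc M ∸ k) (row k)) + sumTo (suc M ∸ suc M) (row (suc M))
    ≡⟨ cong₂ _+_ (sumTo-cong M row-suc) last ⟩
  sumTo M (λ k → sumTo (M ∸ k) (row k) + g k (suc M)) + g (suc M) (suc M)
    ≡⟨ cong (_+ g (suc M) (suc M)) (sumTo-+ M _ _) ⟩
  sumTo M (λ k → sumTo (M ∸ k) (row k)) + sumTo M (λ k → g k (suc M)) + g (suc M) (suc M)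
    ≡⟨ cong (λ s → s + sumTo M (λ k → g k (suc M)) + g (suc M) (suc M)) (sumTo-triangle M g) ⟩
  sumTo M (λ m → sumTo m (λ k → g k m)) + sumTo M (λ k → g k (suc M)) + g (suc M) (suc M)
    ≡⟨ ℚ.+-assoc (sumTo M (λ m → sumTo m (λ k → g k m))) (sumTo M (λ k → g k (suc M))) (g (suc M) (suc M)) ⟩
  sumTo (suc M) (λ m → sumTo m (λ k → g k m)) ∎
  where
  open ≡-Reasoning
  row : ℕ → ℕ → ℚ
  row k i = g k (k ℕ.+ i)
  row-suc : ∀ k → k ≤ M → sumTo (suc M ∸ k) (row k) ≡ sumTo (M ∸ k) (row k) + g k (suc M)
  row-suc k k≤M = trans (cong (λ t → sumTo t (row k)) (+-∸-assoc 1 k≤M))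
    (cong (λ t → sumTo (M ∸ k) (row k) + g k t) (trans (ℕ.+-suc k (M ∸ k)) (cong suc (m+[n∸m]≡n k≤M))))
  last : sumTo (suc M ∸ suc M) (row (suc M)) ≡ g (suc M) (suc M)
  last = trans (cong (λ t → sumTo t (row (suc M))) (ℕ.n∸n≡0 M)) (cong (g (suc M)) (ℕ.+-identityʳ (suc M)))


2*n≡n+n : ∀ n → 2 ℕ.* n ≡ n ℕ.+ n
2*n≡n+n n = cong (n ℕ.+_) (ℕ.+-identityʳ n)

∸-suc : ∀ {m n} → n < m → m ∸ n ≡ suc (m ∸ suc n)
∸-suc {suc m} (s≤s n≤m) = +-∸-assoc 1 n≤m

∸-<-double : ∀ {j k} → j < 2 ℕ.* k → j ∸ k < k
∸-<-double {j} {suc k} j<2k = ℕ.m<n+o⇒m∸n<o j (suc k) (subst (j <_) (2*n≡n+n (suc k)) j<2k)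

m≤⌊n/2⌋⇒2*m≤n : ∀ {n m} → m ≤ ⌊ n /2⌋ → 2 ℕ.* m ≤ n
m≤⌊n/2⌋⇒2*m≤n {n}           {zero}  _ = z≤n
m≤⌊n/2⌋⇒2*m≤n {suc (suc n)} {suc m} (s≤s m≤⌊n/2⌋) =
  subst (_≤ suc (suc n)) (sym (ℕ.*-suc 2 m)) (s≤s (s≤s (m≤⌊n/2⌋⇒2*m≤n m≤⌊n/2⌋)))

⌊n/2⌋<m⇒n<2*m : ∀ {n m} → ⌊ n /2⌋ < m → n < 2 ℕ.* m
⌊n/2⌋<m⇒n<2*m {zero}        {suc m} _ = s≤s z≤n
⌊n/2⌋<m⇒n<2*m {suc zero}    {suc m} _ = subst (1 <_) (sym (ℕ.*-suc 2 m)) (s≤s (s≤s z≤n))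
⌊n/2⌋<m⇒n<2*m {suc (suc n)} {suc m} (s≤s ⌊n/2⌋<m) =
  subst (suc (suc n) <_) (sym (ℕ.*-suc 2 m)) (s≤s (s≤s (⌊n/2⌋<m⇒n<2*m ⌊n/2⌋<m)))

-- U_j in powers of 2x

chebyshevCoeff : ℕ → ℕ → ℚ
chebyshevCoeff j k = sgn k * ℕ→ℚ ((j ∸ k) C k)

chebyshevTerm : ℕ → ℚ → ℕ → ℚ
chebyshevTerm j y k = chebyshevCoeff j k * y ^ (j ∸ 2 ℕ.* k)

chebyshevCoeff-vanishes : ∀ {j k} → j < 2 ℕ.* k → chebyshevCoeff j k ≡ 0ℚ
chebyshevCoeff-vanishes {j} {k} j<2k =
  trans (cong (λ c → sgn k * ℕ→ℚ c) (k>n⇒nCk≡0 {j ∸ k} {k} (∸-<-double {j} {k} j<2k))) (ℚ.*-zeroʳ (sgn k))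

chebyshevTerm-suc : ∀ {j k} y → k ≤ j →
  chebyshevTerm (suc (suc j)) y (suc k) ≡ y * chebyshevTerm (suc j) y (suc k) - chebyshevTerm j y k
chebyshevTerm-suc {j} {k} y k≤j = begin
  - 1ℚ * s * ℕ→ℚ ((suc j ∸ k) C suc k) * y ^ (suc (suc j) ∸ 2 ℕ.* suc k)
    ≡⟨ cong₂ (λ c e → - 1ℚ * s * ℕ→ℚ c * y ^ e)
         (trans (cong (_C suc k) (+-∸-assoc 1 k≤j)) (sym (nCk+nC[k+1]≡[n+1]C[k+1] d k)))
         (cong (suc (suc j) ∸_) (ℕ.*-suc 2 k)) ⟩
  - 1ℚ * s * ℕ→ℚ (d C k ℕ.+ d C suc k) * y ^ e
    ≡⟨ cong (λ c → - 1ℚ * s * c * y ^ e) (ℕ→ℚ-+ (d C k) (d C suc k)) ⟩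
  - 1ℚ * s * (a + b) * y ^ e
    ≡⟨ expand s a b (y ^ e) ⟩
  - (s * (b * y ^ e)) - s * a * y ^ e
    ≡⟨ cong (λ t → - (s * t) - s * a * y ^ e) lower ⟩
  - (s * (y * (b * y ^ (j ∸ suc (2 ℕ.* k))))) - s * a * y ^ e
    ≡⟨ collect s b y (y ^ (j ∸ suc (2 ℕ.* k))) (s * a * y ^ e) ⟩
  y * (- 1ℚ * s * b * y ^ (j ∸ suc (2 ℕ.* k))) - s * a * y ^ e
    ≡⟨ cong (λ e′ → y * (- 1ℚ * s * b * y ^ e′) - s * a * y ^ e) (cong (suc j ∸_) (ℕ.*-suc 2 k)) ⟨
  y * chebyshevTerm (suc j) y (suc k) - chebyshevTerm j y k ∎
  where
  open ≡-Reasoning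
  s = sgn k
  d = j ∸ k
  e = j ∸ 2 ℕ.* k
  a = ℕ→ℚ (d C k)
  b = ℕ→ℚ (d C suc k)
  expand : ∀ s a b p → - 1ℚ * s * (a + b) * p ≡ - (s * (b * p)) - s * a * p
  expand = solve-∀ ℚ-ring
  collect : ∀ s b y q r → - (s * (y * (b * q))) - r ≡ y * (- 1ℚ * s * b * q) - r
  collect = solve-∀ ℚ-ring
  lower : b * y ^ e ≡ y * (b * y ^ (j ∸ suc (2 ℕ.* k)))
  lower with 2 ℕ.* k ℕ.<? j
  ... | yes 2k<j = trans (cong (λ t → b * y ^ t) (∸-suc 2k<j)) (swap b y (y ^ (j ∸ suc (2 ℕ.* k))))
    where swap : ∀ b y q → b * (y * q) ≡ y * (b * q)
          swap = solve-∀ ℚ-ring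
  ... | no 2k≮j = begin
    b * y ^ e                              ≡⟨ cong (_* y ^ e) b≡0 ⟩
    0ℚ * y ^ e                             ≡⟨ ℚ.*-zeroˡ (y ^ e) ⟩
    0ℚ                                     ≡⟨ zero-right y (y ^ (j ∸ suc (2 ℕ.* k))) ⟨
    y * (0ℚ * y ^ (j ∸ suc (2 ℕ.* k)))     ≡⟨ cong (λ c → y * (c * y ^ (j ∸ suc (2 ℕ.* k)))) b≡0 ⟨
    y * (b * y ^ (j ∸ suc (2 ℕ.* k)))      ∎
    where
    d≤k : d ≤ k
    d≤k = ℕ.m≤n+o⇒m∸n≤o j k (subst (j ≤_) (2*n≡n+n k) (ℕ.≮⇒≥ 2k≮j))
    b≡0 : b ≡ 0ℚ
    b≡0 = cong ℕ→ℚ (k>n⇒nCk≡0 (s≤s d≤k))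
    zero-right : ∀ y q → y * (0ℚ * q) ≡ 0ℚ
    zero-right = solve-∀ ℚ-ring

U-power-expansion : ∀ j x → U j x ≡ sumTo j (chebyshevTerm j (ℕ→ℚ 2 * x))
U-power-expansion zero          x = refl
U-power-expansion (suc zero)    x = lemma (ℕ→ℚ 2 * x)
  where lemma : ∀ y → y ≡ 1ℚ * 1ℚ * (y * 1ℚ) + - 1ℚ * 1ℚ * 0ℚ * 1ℚ
        lemma = solve-∀ ℚ-ring
U-power-expansion (suc (suc j)) x = begin
  y * U (suc j) x - U j x
    ≡⟨ cong₂ (λ u v → y * u - v) (U-power-expansion (suc j) x) (U-power-expansion j x) ⟩
  y * sumTo (suc j) (t (suc j)) - sumTo j (t j)
    ≡⟨ cong (λ u → y * u - sumTo j (t j)) (sumTo-suc j (t (suc j))) ⟩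
  y * (t (suc j) 0 + sumTo j (λ k → t (suc j) (suc k))) - sumTo j (t j)
    ≡⟨ rearrange y (t (suc j) 0) _ _ ⟩
  y * t (suc j) 0 + (y * sumTo j (λ k → t (suc j) (suc k)) - sumTo j (t j) + 0ℚ)
    ≡⟨ cong₂ (λ u v → y * t (suc j) 0 + (u - sumTo j (t j) + v))
         (*-distribˡ-sumTo j y (λ k → t (suc j) (suc k))) (sym top) ⟩
  y * t (suc j) 0 + (sumTo j (λ k → y * t (suc j) (suc k)) - sumTo j (t j) + t (suc (suc j)) (suc (suc j)))
    ≡⟨ cong (λ u → y * t (suc j) 0 + (u + t (suc (suc j)) (suc (suc j))))
         (trans (sym (sumTo-- j _ (t j))) (sumTo-cong j (λ k k≤j → sym (chebyshevTerm-suc y k≤j)))) ⟩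
  y * t (suc j) 0 + sumTo (suc j) (λ k → t (suc (suc j)) (suc k))
    ≡⟨ cong (_+ sumTo (suc j) (λ k → t (suc (suc j)) (suc k))) (first y (y ^ suc j)) ⟩
  t (suc (suc j)) 0 + sumTo (suc j) (λ k → t (suc (suc j)) (suc k))
    ≡⟨ sumTo-suc (suc j) (t (suc (suc j))) ⟨
  sumTo (suc (suc j)) (t (suc (suc j))) ∎
  where
  open ≡-Reasoning
  y = ℕ→ℚ 2 * x
  t : ℕ → ℕ → ℚ
  t j = chebyshevTerm j y
  rearrange : ∀ y a b c → y * (a + b) - c ≡ y * a + (y * b - c + 0ℚ)
  rearrange = solve-∀ ℚ-ring
  first : ∀ y p → y * (1ℚ * 1ℚ * p) ≡ 1ℚ * 1ℚ * (y * p)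
  first = solve-∀ ℚ-ring
  top : t (suc (suc j)) (suc (suc j)) ≡ 0ℚ
  top = trans (cong (_* y ^ (suc (suc j) ∸ 2 ℕ.* suc (suc j)))
               (chebyshevCoeff-vanishes {suc (suc j)} {suc (suc j)} (ℕ.m<m+n (suc (suc j)) ℕ.z<s)))
              (ℚ.*-zeroˡ (y ^ (suc (suc j) ∸ 2 ℕ.* suc (suc j))))

-- Powers of x in the Fibonacci basis

ballot : ℕ → ℕ → ℚ
ballot n zero    = 1ℚ
ballot n (suc i) = ℕ→ℚ (n C suc i) - ℕ→ℚ (n C i)

ballot-suc : ∀ n i → ballot (suc n) (suc i) ≡ ballot n (suc i) + ballot n i
ballot-suc n zero = begin
  ℕ→ℚ (suc n C 1) - 1ℚ          ≡⟨ cong (λ c → ℕ→ℚ c - 1ℚ) (nCk+nC[k+1]≡[n+1]C[k+1] n 0) ⟨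
  ℕ→ℚ (suc (n C 1)) - 1ℚ        ≡⟨ cong (_- 1ℚ) (ℕ→ℚ-suc (n C 1)) ⟩
  1ℚ + ℕ→ℚ (n C 1) - 1ℚ         ≡⟨ shuffle (ℕ→ℚ (n C 1)) ⟩
  ℕ→ℚ (n C 1) - 1ℚ + 1ℚ         ∎
  where open ≡-Reasoning
        shuffle : ∀ a → 1ℚ + a - 1ℚ ≡ a - 1ℚ + 1ℚ
        shuffle = solve-∀ ℚ-ring
ballot-suc n (suc i) = begin
  ℕ→ℚ (suc n C suc (suc i)) - ℕ→ℚ (suc n C suc i)
    ≡⟨ cong₂ (λ a b → ℕ→ℚ a - ℕ→ℚ b) (sym (nCk+nC[k+1]≡[n+1]C[k+1] n (suc i))) (sym (nCk+nC[k+1]≡[n+1]C[k+1] n i)) ⟩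
  ℕ→ℚ (n C suc i ℕ.+ n C suc (suc i)) - ℕ→ℚ (n C i ℕ.+ n C suc i)
    ≡⟨ cong₂ _-_ (ℕ→ℚ-+ (n C suc i) _) (ℕ→ℚ-+ (n C i) _) ⟩
  ℕ→ℚ (n C suc i) + ℕ→ℚ (n C suc (suc i)) - (ℕ→ℚ (n C i) + ℕ→ℚ (n C suc i))
    ≡⟨ shuffle (ℕ→ℚ (n C i)) (ℕ→ℚ (n C suc i)) (ℕ→ℚ (n C suc (suc i))) ⟩
  ℕ→ℚ (n C suc (suc i)) - ℕ→ℚ (n C suc i) + (ℕ→ℚ (n C suc i) - ℕ→ℚ (n C i)) ∎
  where open ≡-Reasoning
        shuffle : ∀ a b c → b + c - (a + b) ≡ c - b + (b - a)
        shuffle = solve-∀ ℚ-ring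

ballot-middle : ∀ {n i} → 2 ℕ.* i ≡ suc n → ballot n i ≡ 0ℚ
ballot-middle {n} {suc i} 2i≡1+n = trans (cong (λ c → ℕ→ℚ c - ℕ→ℚ (n C i)) symmetric) (ℚ.+-inverseʳ (ℕ→ℚ (n C i)))
  where
  n≡1+i+i : n ≡ suc i ℕ.+ i
  n≡1+i+i = ℕ.suc-injective (trans (sym 2i≡1+n) (trans (2*n≡n+n (suc i)) (cong suc (ℕ.+-suc i i))))
  symmetric : n C suc i ≡ n C i
  symmetric = trans (nCk≡nC[n∸k] (subst (suc i ≤_) (sym n≡1+i+i) (ℕ.m≤m+n (suc i) i)))
                    (cong (n C_) (trans (cong (_∸ suc i) n≡1+i+i) (m+n∸m≡n (suc i) i)))

fibonacciCoeff : ℕ → ℕ → ℚ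
fibonacciCoeff n i = sgn i * ballot n i

fibonacciTerm : ℕ → ℚ → ℕ → ℚ
fibonacciTerm n x i = fibonacciCoeff n i * F (suc n ∸ 2 ℕ.* i) x

F-vanishes : ∀ {n i} x → n < 2 ℕ.* i → F (suc n ∸ 2 ℕ.* i) x ≡ 0ℚ
F-vanishes x n<2i = cong (λ m → F m x) (m≤n⇒m∸n≡0 n<2i)

-- For 2i = n + 1 the truncated indices break x F_m = F_(m+1) - F_(m-1), but there b(n,i) = 0.
x*fibonacciTerm : ∀ n x i → x * fibonacciTerm n x i ≡
  fibonacciCoeff n i * F (suc (suc n) ∸ 2 ℕ.* i) x - fibonacciCoeff n i * F (n ∸ 2 ℕ.* i) x
x*fibonacciTerm n x i with <-cmp (2 ℕ.* i) (suc n)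
... | tri< (s≤s 2i≤n) _ _ =
  trans (cong (λ m → x * (c * F m x)) (+-∸-assoc 1 2i≤n))
    (trans (recurrence x c (F (suc (n ∸ 2 ℕ.* i)) x) (F (n ∸ 2 ℕ.* i) x))
      (cong (λ m → c * F m x - c * F (n ∸ 2 ℕ.* i) x) (sym (+-∸-assoc 2 2i≤n))))
  where c = fibonacciCoeff n i
        recurrence : ∀ x c f₁ f₀ → x * (c * f₁) ≡ c * (x * f₁ + f₀) - c * f₀
        recurrence = solve-∀ ℚ-ring
... | tri≈ _ 2i≡1+n _ = begin
  x * (c * F (suc n ∸ 2 ℕ.* i) x)
    ≡⟨ cong (λ c → x * (c * F (suc n ∸ 2 ℕ.* i) x)) c≡0 ⟩
  x * (0ℚ * F (suc n ∸ 2 ℕ.* i) x)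
    ≡⟨ annihilate x (F (suc n ∸ 2 ℕ.* i) x) (F (suc (suc n) ∸ 2 ℕ.* i) x) (F (n ∸ 2 ℕ.* i) x) ⟩
  0ℚ * F (suc (suc n) ∸ 2 ℕ.* i) x - 0ℚ * F (n ∸ 2 ℕ.* i) x
    ≡⟨ cong (λ c → c * F (suc (suc n) ∸ 2 ℕ.* i) x - c * F (n ∸ 2 ℕ.* i) x) c≡0 ⟨
  c * F (suc (suc n) ∸ 2 ℕ.* i) x - c * F (n ∸ 2 ℕ.* i) x ∎
  where open ≡-Reasoning
        c = fibonacciCoeff n i
        c≡0 : c ≡ 0ℚ
        c≡0 = trans (cong (sgn i *_) (ballot-middle {n} {i} 2i≡1+n)) (ℚ.*-zeroʳ (sgn i))
        annihilate : ∀ x p q r → x * (0ℚ * p) ≡ 0ℚ * q - 0ℚ * r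
        annihilate = solve-∀ ℚ-ring
... | tri> _ _ 1+n<2i =
  trans (cong (λ m → x * (c * F m x)) (m≤n⇒m∸n≡0 (<⇒≤ 1+n<2i)))
    (trans (annihilate x c)
      (cong₂ (λ m m′ → c * F m x - c * F m′ x) (sym (m≤n⇒m∸n≡0 1+n<2i))
             (sym (m≤n⇒m∸n≡0 (<⇒≤ (<⇒≤ 1+n<2i))))))
  where c = fibonacciCoeff n i
        annihilate : ∀ x c → x * (c * 0ℚ) ≡ c * 0ℚ - c * 0ℚ
        annihilate = solve-∀ ℚ-ring

power-fibonacci-expansion : ∀ n x → x ^ n ≡ sumTo n (fibonacciTerm n x)
power-fibonacci-expansion zero    x = refl
power-fibonacci-expansion (suc n) x = begin
  x * x ^ n                                          ≡⟨ cong (x *_) (power-fibonacci-expansion n x) ⟩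
  x * sumTo n (fibonacciTerm n x)                    ≡⟨ *-distribˡ-sumTo n x (fibonacciTerm n x) ⟩
  sumTo n (λ i → x * fibonacciTerm n x i)            ≡⟨ sumTo-cong n (λ i _ → x*fibonacciTerm n x i) ⟩
  sumTo n (λ i → P i - Q i)                          ≡⟨ sumTo-- n P Q ⟩
  sumTo n P - sumTo n Q                              ≡⟨ cong (_- sumTo n Q) (sumTo-extend (suc n) P-top (ℕ.n≤1+n n)) ⟨
  sumTo (suc n) P - sumTo n Q                        ≡⟨ cong (_- sumTo n Q) (sumTo-suc n P) ⟩
  P 0 + sumTo n (λ i → P (suc i)) - sumTo n Q        ≡⟨ ℚ.+-assoc (P 0) _ _ ⟩
  P 0 + (sumTo n (λ i → P (suc i)) - sumTo n Q)      ≡⟨ cong (P 0 +_) (sumTo-- n (λ i → P (suc i)) Q) ⟨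
  P 0 + sumTo n (λ i → P (suc i) - Q i)              ≡⟨ cong (P 0 +_) (sumTo-cong n (λ i _ → sym (fibonacciTerm-suc i))) ⟩
  P 0 + sumTo n (λ i → fibonacciTerm (suc n) x (suc i)) ≡⟨ sumTo-suc n (fibonacciTerm (suc n) x) ⟨
  sumTo (suc n) (fibonacciTerm (suc n) x)            ∎
  where
  open ≡-Reasoning
  P Q : ℕ → ℚ
  P i = fibonacciCoeff n i * F (suc (suc n) ∸ 2 ℕ.* i) x
  Q i = fibonacciCoeff n i * F (n ∸ 2 ℕ.* i) x
  P-top : ∀ i → n < i → P i ≡ 0ℚ
  P-top i n<i = trans (cong (fibonacciCoeff n i *_) (F-vanishes {suc n} {i} x 1+n<2i)) (ℚ.*-zeroʳ (fibonacciCoeff n i))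
    where 1+n<2i : suc n < 2 ℕ.* i
          1+n<2i = subst (suc n <_) (sym (2*n≡n+n i))
                     (≤-trans (s≤s (ℕ.m≤n+m (suc n) n)) (ℕ.+-mono-≤ n<i n<i))
  fibonacciTerm-suc : ∀ i → fibonacciTerm (suc n) x (suc i) ≡ P (suc i) - Q i
  fibonacciTerm-suc i = begin
    - 1ℚ * sgn i * ballot (suc n) (suc i) * f
      ≡⟨ cong (λ b → - 1ℚ * sgn i * b * f) (ballot-suc n i) ⟩
    - 1ℚ * sgn i * (ballot n (suc i) + ballot n i) * f
      ≡⟨ split (sgn i) (ballot n (suc i)) (ballot n i) f ⟩
    - 1ℚ * sgn i * ballot n (suc i) * f - sgn i * ballot n i * f
      ≡⟨ cong (λ m → P (suc i) - sgn i * ballot n i * F m x) (cong (suc (suc n) ∸_) (ℕ.*-suc 2 i)) ⟩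
    P (suc i) - Q i ∎
    where f = F (suc (suc n) ∸ 2 ℕ.* suc i) x
          split : ∀ s b₁ b₀ f → - 1ℚ * s * (b₁ + b₀) * f ≡ - 1ℚ * s * b₁ * f - s * b₀ * f
          split = solve-∀ ℚ-ring

-- U_j in the Fibonacci basis

chebyshevFibonacciSummand : ℕ → ℕ → ℕ → ℚ
chebyshevFibonacciSummand j m k =
  chebyshevCoeff j k * ℕ→ℚ 2 ^ (j ∸ 2 ℕ.* k) * fibonacciCoeff (j ∸ 2 ℕ.* k) (m ∸ k)

chebyshevFibonacciCoeff : ℕ → ℕ → ℚ
chebyshevFibonacciCoeff j m = sumTo m (chebyshevFibonacciSummand j m)

chebyshevFibonacciTerm : ℕ → ℚ → ℕ → ℕ → ℚ
chebyshevFibonacciTerm j x k m = chebyshevFibonacciSummand j m k * F (suc j ∸ 2 ℕ.* m) x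

chebyshevTerm-expansion : ∀ j x k →
  chebyshevTerm j (ℕ→ℚ 2 * x) k ≡ sumTo (j ∸ k) (λ i → chebyshevFibonacciTerm j x k (k ℕ.+ i))
chebyshevTerm-expansion j x k with 2 ℕ.* k ℕ.≤? j
... | yes 2k≤j = begin
  c * (ℕ→ℚ 2 * x) ^ n                                ≡⟨ cong (c *_) (^-* (ℕ→ℚ 2) x n) ⟩
  c * (ℕ→ℚ 2 ^ n * x ^ n)                            ≡⟨ ℚ.*-assoc c (ℕ→ℚ 2 ^ n) (x ^ n) ⟨
  c * ℕ→ℚ 2 ^ n * x ^ n                              ≡⟨ cong (c * ℕ→ℚ 2 ^ n *_) (power-fibonacci-expansion n x) ⟩
  c * ℕ→ℚ 2 ^ n * sumTo n (fibonacciTerm n x)        ≡⟨ cong (c * ℕ→ℚ 2 ^ n *_) (sumTo-extend (j ∸ k) tail n≤j∸k) ⟨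
  c * ℕ→ℚ 2 ^ n * sumTo (j ∸ k) (fibonacciTerm n x)  ≡⟨ *-distribˡ-sumTo (j ∸ k) (c * ℕ→ℚ 2 ^ n) (fibonacciTerm n x) ⟩
  sumTo (j ∸ k) (λ i → c * ℕ→ℚ 2 ^ n * fibonacciTerm n x i)
    ≡⟨ sumTo-cong (j ∸ k) (λ i _ → reindex i) ⟩
  sumTo (j ∸ k) (λ i → chebyshevFibonacciTerm j x k (k ℕ.+ i)) ∎
  where
  open ≡-Reasoning
  c = chebyshevCoeff j k
  n = j ∸ 2 ℕ.* k
  n≤j∸k : n ≤ j ∸ k
  n≤j∸k = ℕ.∸-monoʳ-≤ j (ℕ.m≤m+n k (k ℕ.+ 0))
  tail : ∀ i → n < i → fibonacciTerm n x i ≡ 0ℚ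
  tail i n<i = trans (cong (fibonacciCoeff n i *_) (F-vanishes {n} {i} x (≤-trans n<i (ℕ.m≤m+n i (i ℕ.+ 0)))))
                     (ℚ.*-zeroʳ (fibonacciCoeff n i))
  index : ∀ i → suc j ∸ 2 ℕ.* (k ℕ.+ i) ≡ suc n ∸ 2 ℕ.* i
  index i = begin
    suc j ∸ 2 ℕ.* (k ℕ.+ i)              ≡⟨ cong (suc j ∸_) (ℕ.*-distribˡ-+ 2 k i) ⟩
    suc j ∸ (2 ℕ.* k ℕ.+ 2 ℕ.* i)        ≡⟨ ℕ.∸-+-assoc (suc j) (2 ℕ.* k) (2 ℕ.* i) ⟨
    suc j ∸ 2 ℕ.* k ∸ 2 ℕ.* i            ≡⟨ cong (_∸ 2 ℕ.* i) (+-∸-assoc 1 2k≤j) ⟩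
    suc n ∸ 2 ℕ.* i                      ∎
  reindex : ∀ i → c * ℕ→ℚ 2 ^ n * fibonacciTerm n x i ≡ chebyshevFibonacciTerm j x k (k ℕ.+ i)
  reindex i = trans (sym (ℚ.*-assoc (c * ℕ→ℚ 2 ^ n) (fibonacciCoeff n i) (F (suc n ∸ 2 ℕ.* i) x)))
    (cong₂ (λ i′ m → c * ℕ→ℚ 2 ^ n * fibonacciCoeff n i′ * F m x) (sym (m+n∸m≡n k i)) (sym (index i)))
... | no 2k≰j = begin
  c * (ℕ→ℚ 2 * x) ^ (j ∸ 2 ℕ.* k)     ≡⟨ cong (_* (ℕ→ℚ 2 * x) ^ (j ∸ 2 ℕ.* k)) c≡0 ⟩
  0ℚ * (ℕ→ℚ 2 * x) ^ (j ∸ 2 ℕ.* k)    ≡⟨ ℚ.*-zeroˡ ((ℕ→ℚ 2 * x) ^ (j ∸ 2 ℕ.* k)) ⟩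
  0ℚ                                  ≡⟨ sumTo-0 (j ∸ k) ⟨
  sumTo (j ∸ k) (λ _ → 0ℚ)             ≡⟨ sumTo-cong (j ∸ k) (λ i _ → sym (term≡0 i)) ⟩
  sumTo (j ∸ k) (λ i → chebyshevFibonacciTerm j x k (k ℕ.+ i)) ∎
  where
  open ≡-Reasoning
  c = chebyshevCoeff j k
  c≡0 : c ≡ 0ℚ
  c≡0 = chebyshevCoeff-vanishes {j} {k} (ℕ.≰⇒> 2k≰j)
  annihilate : ∀ p q f → 0ℚ * p * q * f ≡ 0ℚ
  annihilate = solve-∀ ℚ-ring
  term≡0 : ∀ i → chebyshevFibonacciTerm j x k (k ℕ.+ i) ≡ 0ℚ
  term≡0 i = trans (cong (λ c → c * p * q * f) c≡0) (annihilate p q f)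
    where p = ℕ→ℚ 2 ^ (j ∸ 2 ℕ.* k)
          q = fibonacciCoeff (j ∸ 2 ℕ.* k) (k ℕ.+ i ∸ k)
          f = F (suc j ∸ 2 ℕ.* (k ℕ.+ i)) x

U-fibonacci-expansion : ∀ j x →
  U j x ≡ sumTo ⌊ j /2⌋ (λ m → chebyshevFibonacciCoeff j m * F (suc j ∸ 2 ℕ.* m) x)
U-fibonacci-expansion j x = begin
  U j x
    ≡⟨ U-power-expansion j x ⟩
  sumTo j (chebyshevTerm j (ℕ→ℚ 2 * x))
    ≡⟨ sumTo-cong j (λ k _ → chebyshevTerm-expansion j x k) ⟩
  sumTo j (λ k → sumTo (j ∸ k) (λ i → chebyshevFibonacciTerm j x k (k ℕ.+ i)))
    ≡⟨ sumTo-triangle j (chebyshevFibonacciTerm j x) ⟩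
  sumTo j (λ m → sumTo m (λ k → chebyshevFibonacciTerm j x k m))
    ≡⟨ sumTo-cong j (λ m _ → sym (*-distribʳ-sumTo m (F (suc j ∸ 2 ℕ.* m) x) (chebyshevFibonacciSummand j m))) ⟩
  sumTo j h
    ≡⟨ sumTo-extend j h-vanishes (ℕ.⌊n/2⌋≤n j) ⟩
  sumTo ⌊ j /2⌋ h ∎
  where
  open ≡-Reasoning
  h : ℕ → ℚ
  h m = chebyshevFibonacciCoeff j m * F (suc j ∸ 2 ℕ.* m) x
  h-vanishes : ∀ m → ⌊ j /2⌋ < m → h m ≡ 0ℚ
  h-vanishes m ⌊j/2⌋<m =
    trans (cong (chebyshevFibonacciCoeff j m *_) (F-vanishes {j} {m} x (⌊n/2⌋<m⇒n<2*m ⌊j/2⌋<m)))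
          (ℚ.*-zeroʳ (chebyshevFibonacciCoeff j m))

fact-! : ∀ n → fact n ≡ ℕ→ℚ (n !)
fact-! zero    = refl
fact-! (suc n) = trans (cong (_* ℕ→ℚ (suc n)) (fact-! n))
  (trans (ℚ.*-comm (ℕ→ℚ (n !)) (ℕ→ℚ (suc n))) (sym (ℕ→ℚ-* (suc n) (n !))))

fact⁻¹ : ℕ → ℚ
fact⁻¹ n = 1ℚ ÷' fact n

fact*fact⁻¹ : ∀ n → fact n * fact⁻¹ n ≡ 1ℚ
fact*fact⁻¹ n = *-÷'-inverse (subst (_≢ 0ℚ) (sym (fact-! n)) (ℕ→ℚ-≢0 (n !) {{n !≢0}}))

fact⁻¹*fact : ∀ n → fact⁻¹ n * fact n ≡ 1ℚ
fact⁻¹*fact n = trans (ℚ.*-comm (fact⁻¹ n) (fact n)) (fact*fact⁻¹ n)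

fact⁻¹-suc : ∀ n → fact⁻¹ n ≡ ℕ→ℚ (suc n) * fact⁻¹ (suc n)
fact⁻¹-suc n = trans (÷'-inverse 1ℚ {fact n} inverse) (ℚ.*-identityˡ (ℕ→ℚ (suc n) * fact⁻¹ (suc n)))
  where inverse : fact n * (ℕ→ℚ (suc n) * fact⁻¹ (suc n)) ≡ 1ℚ
        inverse = trans (sym (ℚ.*-assoc (fact n) (ℕ→ℚ (suc n)) (fact⁻¹ (suc n)))) (fact*fact⁻¹ (suc n))

C*fact*fact≡fact : ∀ a b → ℕ→ℚ ((a ℕ.+ b) C a) * (fact a * fact b) ≡ fact (a ℕ.+ b)
C*fact*fact≡fact a b = begin
  ℕ→ℚ (n C a) * (fact a * fact b)        ≡⟨ cong₂ (λ u v → ℕ→ℚ (n C a) * (u * v)) (fact-! a) (fact-! b) ⟩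
  ℕ→ℚ (n C a) * (ℕ→ℚ (a !) * ℕ→ℚ (b !))  ≡⟨ cong (ℕ→ℚ (n C a) *_) (ℕ→ℚ-* (a !) (b !)) ⟨
  ℕ→ℚ (n C a) * ℕ→ℚ (a ! ℕ.* b !)        ≡⟨ ℕ→ℚ-* (n C a) (a ! ℕ.* b !) ⟨
  ℕ→ℚ ((n C a) ℕ.* (a ! ℕ.* b !))        ≡⟨ cong ℕ→ℚ binomialℕ ⟩
  ℕ→ℚ (n !)                              ≡⟨ fact-! n ⟨
  fact n                                 ∎
  where
  open ≡-Reasoning
  n = a ℕ.+ b
  a≤n : a ≤ n
  a≤n = ℕ.m≤m+n a b
  binomialℕ : (n C a) ℕ.* (a ! ℕ.* b !) ≡ n !
  binomialℕ = subst (λ c → (n C a) ℕ.* (a ! ℕ.* c !) ≡ n !) (m+n∸m≡n a b)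
    (trans (cong (ℕ._* (a ! ℕ.* (n ∸ a) !)) (nCk≡n!/k![n-k]! a≤n))
           (m/n*n≡m {{a !* (n ∸ a) !≢0}} (k![n∸k]!∣n! a≤n)))

binomial≡fact : ∀ {n} a b → n ≡ a ℕ.+ b → ℕ→ℚ (n C a) ≡ fact n * fact⁻¹ a * fact⁻¹ b
binomial≡fact a b refl = begin
  X                                               ≡⟨ pad X ⟩
  X * 1ℚ * 1ℚ                                     ≡⟨ cong₂ (λ u v → X * u * v) (fact*fact⁻¹ a) (fact*fact⁻¹ b) ⟨
  X * (fact a * fact⁻¹ a) * (fact b * fact⁻¹ b)   ≡⟨ regroup X (fact a) (fact⁻¹ a) (fact b) (fact⁻¹ b) ⟩
  X * (fact a * fact b) * fact⁻¹ a * fact⁻¹ b     ≡⟨ cong (λ t → t * fact⁻¹ a * fact⁻¹ b) (C*fact*fact≡fact a b) ⟩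
  fact (a ℕ.+ b) * fact⁻¹ a * fact⁻¹ b            ∎
  where
  open ≡-Reasoning
  X = ℕ→ℚ ((a ℕ.+ b) C a)
  pad : ∀ x → x ≡ x * 1ℚ * 1ℚ
  pad = solve-∀ ℚ-ring
  regroup : ∀ x p p′ q q′ → x * (p * p′) * (q * q′) ≡ x * (p * q) * p′ * q′
  regroup = solve-∀ ℚ-ring

poch-neg : ∀ {n} k {d} → n ≡ k ℕ.+ d → poch (- ℕ→ℚ n) k ≡ sgn k * fact n * fact⁻¹ d
poch-neg zero {d} refl = sym (trans (cong (_* fact⁻¹ d) (ℚ.*-identityˡ (fact d))) (fact*fact⁻¹ d))
poch-neg {n} (suc k) {d} n≡1+k+d = begin
  poch (- ℕ→ℚ n) k * (- ℕ→ℚ n + ℕ→ℚ k)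
    ≡⟨ cong₂ (λ p c → p * (- c + ℕ→ℚ k)) (poch-neg k n≡k+1+d) (trans (cong ℕ→ℚ n≡k+1+d) (ℕ→ℚ-+ k (suc d))) ⟩
  sgn k * fact n * fact⁻¹ (suc d) * (- (ℕ→ℚ k + ℕ→ℚ (suc d)) + ℕ→ℚ k)
    ≡⟨ regroup (sgn k) (fact n) (fact⁻¹ (suc d)) (ℕ→ℚ k) (ℕ→ℚ (suc d)) ⟩
  - 1ℚ * sgn k * fact n * (ℕ→ℚ (suc d) * fact⁻¹ (suc d))
    ≡⟨ cong (- 1ℚ * sgn k * fact n *_) (fact⁻¹-suc d) ⟨
  sgn (suc k) * fact n * fact⁻¹ d ∎
  where
  open ≡-Reasoning
  n≡k+1+d : n ≡ k ℕ.+ suc d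
  n≡k+1+d = trans n≡1+k+d (sym (ℕ.+-suc k d))
  regroup : ∀ s f f′ K D → s * f * f′ * (- (K + D) + K) ≡ - 1ℚ * s * f * (D * f′)
  regroup = solve-∀ ℚ-ring

ballot≡fact : ∀ {n} i r → n ≡ i ℕ.+ i ℕ.+ r →
  ballot n i ≡ ℕ→ℚ (suc r) * fact n * fact⁻¹ i * fact⁻¹ (suc (i ℕ.+ r))
ballot≡fact zero r refl = sym (begin
  ℕ→ℚ (suc r) * fact r * 1ℚ * fact⁻¹ (suc r)    ≡⟨ regroup (ℕ→ℚ (suc r)) (fact r) (fact⁻¹ (suc r)) ⟩
  fact r * ℕ→ℚ (suc r) * fact⁻¹ (suc r)         ≡⟨ fact*fact⁻¹ (suc r) ⟩
  1ℚ                                            ∎)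
  where open ≡-Reasoning
        regroup : ∀ s f f′ → s * f * 1ℚ * f′ ≡ f * s * f′
        regroup = solve-∀ ℚ-ring
ballot≡fact {n} (suc i) r n≡2+2i+r = begin
  ℕ→ℚ (n C suc i) - ℕ→ℚ (n C i)
    ≡⟨ cong₂ _-_ (binomial≡fact (suc i) (suc (i ℕ.+ r)) (trans n≡2+2i+r (shape₁ i r)))
                 (binomial≡fact i (suc (suc (i ℕ.+ r))) (trans n≡2+2i+r (shape₀ i r))) ⟩
  f * a * fact⁻¹ (suc (i ℕ.+ r)) - f * fact⁻¹ i * c
    ≡⟨ cong₂ (λ u v → f * a * u - f * v * c) (fact⁻¹-suc (suc (i ℕ.+ r))) (fact⁻¹-suc i) ⟩
  f * a * (ℕ→ℚ (suc (suc (i ℕ.+ r))) * c) - f * (ℕ→ℚ (suc i) * a) * c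
    ≡⟨ collect f a c (ℕ→ℚ (suc (suc (i ℕ.+ r)))) (ℕ→ℚ (suc i)) ⟩
  (ℕ→ℚ (suc (suc (i ℕ.+ r))) - ℕ→ℚ (suc i)) * f * a * c
    ≡⟨ cong (λ u → u * f * a * c) difference ⟩
  ℕ→ℚ (suc r) * f * a * c ∎
  where
  open ≡-Reasoning
  f = fact n
  a = fact⁻¹ (suc i)
  c = fact⁻¹ (suc (suc (i ℕ.+ r)))
  shape₁ : ∀ i r → suc i ℕ.+ suc i ℕ.+ r ≡ suc i ℕ.+ suc (i ℕ.+ r)
  shape₁ = ℕ-Solver.solve-∀
  shape₀ : ∀ i r → suc i ℕ.+ suc i ℕ.+ r ≡ i ℕ.+ suc (suc (i ℕ.+ r))
  shape₀ = ℕ-Solver.solve-∀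
  shape : ∀ i r → suc (suc (i ℕ.+ r)) ≡ suc i ℕ.+ suc r
  shape = ℕ-Solver.solve-∀
  collect : ∀ f a c B A → f * a * (B * c) - f * (A * a) * c ≡ (B - A) * f * a * c
  collect = solve-∀ ℚ-ring
  cancel : ∀ a b → a + b - a ≡ b
  cancel = solve-∀ ℚ-ring
  difference : ℕ→ℚ (suc (suc (i ℕ.+ r))) - ℕ→ℚ (suc i) ≡ ℕ→ℚ (suc r)
  difference = trans (cong (λ t → ℕ→ℚ t - ℕ→ℚ (suc i)) (shape i r))
    (trans (cong (_- ℕ→ℚ (suc i)) (ℕ→ℚ-+ (suc i) (suc r))) (cancel (ℕ→ℚ (suc i)) (ℕ→ℚ (suc r))))

-- The hypergeometric side

¼ : ℚ
¼ = 1ℚ ÷' ℕ→ℚ 4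

2^[k+[k+n]]*¼^k≡2^n : ∀ k n → ℕ→ℚ 2 ^ (k ℕ.+ (k ℕ.+ n)) * ¼ ^ k ≡ ℕ→ℚ 2 ^ n
2^[k+[k+n]]*¼^k≡2^n k n = begin
  ℕ→ℚ 2 ^ (k ℕ.+ (k ℕ.+ n)) * ¼ ^ k
    ≡⟨ cong (_* ¼ ^ k) (trans (^-+ (ℕ→ℚ 2) k (k ℕ.+ n)) (cong (ℕ→ℚ 2 ^ k *_) (^-+ (ℕ→ℚ 2) k n))) ⟩
  ℕ→ℚ 2 ^ k * (ℕ→ℚ 2 ^ k * ℕ→ℚ 2 ^ n) * ¼ ^ k
    ≡⟨ regroup (ℕ→ℚ 2 ^ k) (ℕ→ℚ 2 ^ n) (¼ ^ k) ⟩
  ℕ→ℚ 2 ^ k * ℕ→ℚ 2 ^ k * ¼ ^ k * ℕ→ℚ 2 ^ n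
    ≡⟨ cong (λ t → t * ¼ ^ k * ℕ→ℚ 2 ^ n) (^-* (ℕ→ℚ 2) (ℕ→ℚ 2) k) ⟨
  (ℕ→ℚ 2 * ℕ→ℚ 2) ^ k * ¼ ^ k * ℕ→ℚ 2 ^ n
    ≡⟨ cong (_* ℕ→ℚ 2 ^ n) (^-* (ℕ→ℚ 2 * ℕ→ℚ 2) ¼ k) ⟨
  1ℚ ^ k * ℕ→ℚ 2 ^ n
    ≡⟨ cong (_* ℕ→ℚ 2 ^ n) (1^n≡1 k) ⟩
  1ℚ * ℕ→ℚ 2 ^ n
    ≡⟨ ℚ.*-identityˡ (ℕ→ℚ 2 ^ n) ⟩
  ℕ→ℚ 2 ^ n ∎
  where open ≡-Reasoning
        regroup : ∀ a b c → a * (a * b) * c ≡ a * a * c * b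
        regroup = solve-∀ ℚ-ring

prefactor : ℕ → ℕ → ℚ
prefactor j m = sgn (suc m) * ℕ→ℚ (j C m) * ((- ℕ→ℚ j + ℕ→ℚ (2 ℕ.* m) - 1ℚ) ÷' (ℕ→ℚ j - ℕ→ℚ m + 1ℚ))

j-m+1≡suc[m+r] : ∀ {j} m r → j ≡ m ℕ.+ m ℕ.+ r → ℕ→ℚ j - ℕ→ℚ m + 1ℚ ≡ ℕ→ℚ (suc (m ℕ.+ r))
j-m+1≡suc[m+r] {j} m r j≡2m+r = begin
  ℕ→ℚ j - ℕ→ℚ m + 1ℚ
    ≡⟨ cong (λ u → u - ℕ→ℚ m + 1ℚ) (trans (cong ℕ→ℚ (trans j≡2m+r (ℕ.+-assoc m m r))) (ℕ→ℚ-+ m (m ℕ.+ r))) ⟩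
  ℕ→ℚ m + ℕ→ℚ (m ℕ.+ r) - ℕ→ℚ m + 1ℚ
    ≡⟨ cancel (ℕ→ℚ m) (ℕ→ℚ (m ℕ.+ r)) ⟩
  1ℚ + ℕ→ℚ (m ℕ.+ r)
    ≡⟨ ℕ→ℚ-suc (m ℕ.+ r) ⟨
  ℕ→ℚ (suc (m ℕ.+ r)) ∎
  where open ≡-Reasoning
        cancel : ∀ a b → a + b - a + 1ℚ ≡ 1ℚ + b
        cancel = solve-∀ ℚ-ring

prefactor≡fact : ∀ {j} m r → j ≡ m ℕ.+ m ℕ.+ r →
  prefactor j m ≡ sgn m * ℕ→ℚ (suc r) * fact j * fact⁻¹ m * fact⁻¹ (suc (m ℕ.+ r))
prefactor≡fact {j} m r j≡2m+r = begin
  - 1ℚ * sgn m * ℕ→ℚ (j C m) * ((- J + ℕ→ℚ (2 ℕ.* m) - 1ℚ) ÷' (J - M + 1ℚ))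
    ≡⟨ cong₂ (λ c q → - 1ℚ * sgn m * c * q) (binomial≡fact m (m ℕ.+ r) (trans j≡2m+r (ℕ.+-assoc m m r))) ratio ⟩
  - 1ℚ * sgn m * (fact j * fact⁻¹ m * fact⁻¹ (m ℕ.+ r)) * (- S * (fact (m ℕ.+ r) * fact⁻¹ T))
    ≡⟨ regroup (sgn m) S (fact j) (fact⁻¹ m) (fact⁻¹ T) (fact (m ℕ.+ r)) (fact⁻¹ (m ℕ.+ r)) ⟩
  sgn m * S * fact j * fact⁻¹ m * fact⁻¹ T * (fact⁻¹ (m ℕ.+ r) * fact (m ℕ.+ r))
    ≡⟨ cong (sgn m * S * fact j * fact⁻¹ m * fact⁻¹ T *_) (fact⁻¹*fact (m ℕ.+ r)) ⟩
  sgn m * S * fact j * fact⁻¹ m * fact⁻¹ T * 1ℚ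
    ≡⟨ ℚ.*-identityʳ _ ⟩
  sgn m * S * fact j * fact⁻¹ m * fact⁻¹ T ∎
  where
  open ≡-Reasoning
  J = ℕ→ℚ j
  M = ℕ→ℚ m
  S = ℕ→ℚ (suc r)
  T = suc (m ℕ.+ r)
  numerator : - J + ℕ→ℚ (2 ℕ.* m) - 1ℚ ≡ - S
  numerator = begin
    - J + ℕ→ℚ (2 ℕ.* m) - 1ℚ     ≡⟨ cong (λ u → - J + u - 1ℚ) (trans (cong ℕ→ℚ (2*n≡n+n m)) (ℕ→ℚ-+ m m)) ⟩
    - J + (M + M) - 1ℚ           ≡⟨ rearrange J M ⟩
    M - (J - M + 1ℚ)             ≡⟨ cong (λ u → M - u) (j-m+1≡suc[m+r] m r j≡2m+r) ⟩
    M - ℕ→ℚ T                    ≡⟨ cong (λ t → M - ℕ→ℚ t) (sym (ℕ.+-suc m r)) ⟩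
    M - ℕ→ℚ (m ℕ.+ suc r)        ≡⟨ cong (λ u → M - u) (ℕ→ℚ-+ m (suc r)) ⟩
    M - (M + S)                  ≡⟨ cancel M S ⟩
    - S                          ∎
    where rearrange : ∀ J M → - J + (M + M) - 1ℚ ≡ M - (J - M + 1ℚ)
          rearrange = solve-∀ ℚ-ring
          cancel : ∀ M S → M - (M + S) ≡ - S
          cancel = solve-∀ ℚ-ring
  ratio : (- J + ℕ→ℚ (2 ℕ.* m) - 1ℚ) ÷' (J - M + 1ℚ) ≡ - S * (fact (m ℕ.+ r) * fact⁻¹ T)
  ratio = trans (cong₂ _÷'_ numerator (j-m+1≡suc[m+r] m r j≡2m+r)) (÷'-inverse (- S) {ℕ→ℚ T} inverse)
    where inverse : ℕ→ℚ T * (fact (m ℕ.+ r) * fact⁻¹ T) ≡ 1ℚ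
          inverse = trans (trans (sym (ℚ.*-assoc (ℕ→ℚ T) (fact (m ℕ.+ r)) (fact⁻¹ T)))
                                 (cong (_* fact⁻¹ T) (ℚ.*-comm (ℕ→ℚ T) (fact (m ℕ.+ r)))))
                          (fact*fact⁻¹ T)
  regroup : ∀ s S f a b g g′ → - 1ℚ * s * (f * a * g′) * (- S * (g * b)) ≡ s * S * f * a * b * (g′ * g)
  regroup = solve-∀ ℚ-ring

hyp2F1Term : ℕ → ℚ → ℚ → ℚ → ℕ → ℚ
hyp2F1Term m b c z k = ((poch (- ℕ→ℚ m) k * poch b k) ÷' (poch c k * fact k)) * (z ^ k)

hyp2F1Term≡fact : ∀ {j m} k i r d → m ≡ k ℕ.+ i → j ≡ m ℕ.+ m ℕ.+ r → j ≡ k ℕ.+ d →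
  hyp2F1Term m (- ℕ→ℚ j + ℕ→ℚ m - 1ℚ) (- ℕ→ℚ j) (- ¼) k
    ≡ ¼ ^ k * (fact m * fact⁻¹ i) * (fact (suc (m ℕ.+ r)) * fact⁻¹ (suc (i ℕ.+ r))) * (fact⁻¹ j * fact d * fact⁻¹ k)
hyp2F1Term≡fact {j} {m} k i r d m≡k+i j≡2m+r j≡k+d = begin
  ((poch (- M) k * poch b k) ÷' (poch (- J) k * fact k)) * (- ¼) ^ k
    ≡⟨ cong₂ _*_ (trans (cong (_÷' (poch (- J) k * fact k)) numerator) (÷'-inverse A {poch (- J) k * fact k} inverse))
                 (neg-^ ¼ k) ⟩
  (s * fact m * fact⁻¹ i) * (s * fact T * fact⁻¹ T′) * (s * fact⁻¹ j * fact d * fact⁻¹ k) * (s * ¼ ^ k)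
    ≡⟨ regroup s (fact m) (fact⁻¹ i) (fact T) (fact⁻¹ T′) (fact⁻¹ j) (fact d) (fact⁻¹ k) (¼ ^ k) ⟩
  (s * s) * (s * s) * Y
    ≡⟨ cong₂ (λ u v → u * v * Y) (sgn*sgn k) (sgn*sgn k) ⟩
  1ℚ * 1ℚ * Y
    ≡⟨ ℚ.*-identityˡ Y ⟩
  Y ∎
  where
  open ≡-Reasoning
  J = ℕ→ℚ j
  M = ℕ→ℚ m
  T = suc (m ℕ.+ r)
  T′ = suc (i ℕ.+ r)
  s = sgn k
  b = - J + M - 1ℚ
  A = (s * fact m * fact⁻¹ i) * (s * fact T * fact⁻¹ T′)
  Y = ¼ ^ k * (fact m * fact⁻¹ i) * (fact T * fact⁻¹ T′) * (fact⁻¹ j * fact d * fact⁻¹ k)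
  b≡ : b ≡ - ℕ→ℚ T
  b≡ = trans (negate J M) (cong -_ (j-m+1≡suc[m+r] m r j≡2m+r))
    where negate : ∀ J M → - J + M - 1ℚ ≡ - (J - M + 1ℚ)
          negate = solve-∀ ℚ-ring
  T≡k+T′ : T ≡ k ℕ.+ T′
  T≡k+T′ = trans (cong (λ m → suc (m ℕ.+ r)) m≡k+i) (shape k i r)
    where shape : ∀ k i r → suc (k ℕ.+ i ℕ.+ r) ≡ k ℕ.+ suc (i ℕ.+ r)
          shape = ℕ-Solver.solve-∀
  numerator : poch (- M) k * poch b k ≡ A
  numerator = cong₂ _*_ (poch-neg k m≡k+i) (trans (cong (λ c → poch c k) b≡) (poch-neg k T≡k+T′))
  inverse : poch (- J) k * fact k * (s * fact⁻¹ j * fact d * fact⁻¹ k) ≡ 1ℚ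
  inverse = trans (cong (λ p → p * fact k * (s * fact⁻¹ j * fact d * fact⁻¹ k)) (poch-neg k j≡k+d))
    (*-inverse-* {s * fact j * fact⁻¹ d} {s * fact⁻¹ j * fact d}
      (*-inverse-* {s * fact j} {s * fact⁻¹ j} (*-inverse-* {s} {s} (sgn*sgn k) (fact*fact⁻¹ j)) (fact⁻¹*fact d))
      (fact*fact⁻¹ k))
  regroup : ∀ s a a′ b b′ c c′ c″ q → (s * a * a′) * (s * b * b′) * (s * c * c′ * c″) * (s * q)
    ≡ (s * s) * (s * s) * (q * (a * a′) * (b * b′) * (c * c′ * c″))
  regroup = solve-∀ ℚ-ring

hyp2F1Term≡chebyshevFibonacciSummand : ∀ {j m k i r d n} →
  m ≡ k ℕ.+ i → j ≡ m ℕ.+ m ℕ.+ r → j ≡ k ℕ.+ d → d ≡ k ℕ.+ n → n ≡ i ℕ.+ i ℕ.+ r →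
  ℕ→ℚ 2 ^ j * prefactor j m * hyp2F1Term m (- ℕ→ℚ j + ℕ→ℚ m - 1ℚ) (- ℕ→ℚ j) (- ¼) k
    ≡ sgn k * ℕ→ℚ (d C k) * ℕ→ℚ 2 ^ n * fibonacciCoeff n i
hyp2F1Term≡chebyshevFibonacciSummand {j} {m} {k} {i} {r} {d} {n} m≡k+i j≡2m+r j≡k+d d≡k+n n≡2i+r = begin
  ℕ→ℚ 2 ^ j * prefactor j m * hyp2F1Term m (- ℕ→ℚ j + ℕ→ℚ m - 1ℚ) (- ℕ→ℚ j) (- ¼) k
    ≡⟨ cong₂ (λ p h → ℕ→ℚ 2 ^ j * p * h) (prefactor≡fact m r j≡2m+r) (hyp2F1Term≡fact k i r d m≡k+i j≡2m+r j≡k+d) ⟩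
  ℕ→ℚ 2 ^ j * (sgn m * S * fact j * fact⁻¹ m * fact⁻¹ T)
    * (¼ ^ k * (fact m * fact⁻¹ i) * (fact T * fact⁻¹ T′) * (fact⁻¹ j * fact d * fact⁻¹ k))
    ≡⟨ regroupˡ (ℕ→ℚ 2 ^ j) (¼ ^ k) (sgn m) S (fact j) (fact⁻¹ j) (fact m) (fact⁻¹ m) (fact T) (fact⁻¹ T)
                (fact d) (fact⁻¹ k) (fact⁻¹ i) (fact⁻¹ T′) ⟩
  ℕ→ℚ 2 ^ j * ¼ ^ k * sgn m * ((fact j * fact m * fact T) * (fact⁻¹ j * fact⁻¹ m * fact⁻¹ T)) * W
    ≡⟨ cong₂ (λ p s → p * s * ((fact j * fact m * fact T) * (fact⁻¹ j * fact⁻¹ m * fact⁻¹ T)) * W) powers signs ⟩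
  ℕ→ℚ 2 ^ n * (sgn k * sgn i) * ((fact j * fact m * fact T) * (fact⁻¹ j * fact⁻¹ m * fact⁻¹ T)) * W
    ≡⟨ cong (λ u → ℕ→ℚ 2 ^ n * (sgn k * sgn i) * u * W)
         (trans (*-inverse-* {fact j * fact m} {fact⁻¹ j * fact⁻¹ m}
                   (*-inverse-* {fact j} {fact⁻¹ j} (fact*fact⁻¹ j) (fact*fact⁻¹ m)) (fact*fact⁻¹ T))
                (sym (fact*fact⁻¹ n))) ⟩
  ℕ→ℚ 2 ^ n * (sgn k * sgn i) * (fact n * fact⁻¹ n) * W
    ≡⟨ regroupʳ (ℕ→ℚ 2 ^ n) (sgn k) (sgn i) S (fact n) (fact⁻¹ n) (fact d) (fact⁻¹ k) (fact⁻¹ i) (fact⁻¹ T′) ⟩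
  sgn k * (fact d * fact⁻¹ k * fact⁻¹ n) * ℕ→ℚ 2 ^ n * (sgn i * (S * fact n * fact⁻¹ i * fact⁻¹ T′))
    ≡⟨ cong₂ (λ c b → sgn k * c * ℕ→ℚ 2 ^ n * (sgn i * b)) (binomial≡fact k n d≡k+n) (ballot≡fact i r n≡2i+r) ⟨
  sgn k * ℕ→ℚ (d C k) * ℕ→ℚ 2 ^ n * fibonacciCoeff n i ∎
  where
  open ≡-Reasoning
  S = ℕ→ℚ (suc r)
  T = suc (m ℕ.+ r)
  T′ = suc (i ℕ.+ r)
  W = S * fact d * fact⁻¹ k * fact⁻¹ i * fact⁻¹ T′
  powers : ℕ→ℚ 2 ^ j * ¼ ^ k ≡ ℕ→ℚ 2 ^ n
  powers = trans (cong (λ t → ℕ→ℚ 2 ^ t * ¼ ^ k) (trans j≡k+d (cong (k ℕ.+_) d≡k+n))) (2^[k+[k+n]]*¼^k≡2^n k n)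
  signs : sgn m ≡ sgn k * sgn i
  signs = trans (cong sgn m≡k+i) (sgn-+ k i)
  regroupˡ : ∀ P q s S f f′ g g′ h h′ a b c e →
    P * (s * S * f * g′ * h′) * (q * (g * c) * (h * e) * (f′ * a * b))
      ≡ P * q * s * ((f * g * h) * (f′ * g′ * h′)) * (S * a * b * c * e)
  regroupˡ = solve-∀ ℚ-ring
  regroupʳ : ∀ P s s′ S f f′ a b c e →
    P * (s * s′) * (f * f′) * (S * a * b * c * e) ≡ s * (a * b * f′) * P * (s′ * (S * f * c * e))
  regroupʳ = solve-∀ ℚ-ring

prefactor*hyp2F1≡chebyshevFibonacciCoeff : ∀ {j m} → 2 ℕ.* m ≤ j →
  ℕ→ℚ 2 ^ j * (prefactor j m * hyp2F1 m (- ℕ→ℚ j + ℕ→ℚ m - 1ℚ) (- ℕ→ℚ j) (- ¼)) ≡ chebyshevFibonacciCoeff j m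
prefactor*hyp2F1≡chebyshevFibonacciCoeff {j} {m} 2m≤j = begin
  ℕ→ℚ 2 ^ j * (prefactor j m * sumTo m T)
    ≡⟨ cong (ℕ→ℚ 2 ^ j *_) (*-distribˡ-sumTo m (prefactor j m) T) ⟩
  ℕ→ℚ 2 ^ j * sumTo m (λ k → prefactor j m * T k)
    ≡⟨ *-distribˡ-sumTo m (ℕ→ℚ 2 ^ j) (λ k → prefactor j m * T k) ⟩
  sumTo m (λ k → ℕ→ℚ 2 ^ j * (prefactor j m * T k))
    ≡⟨ sumTo-cong m (λ k k≤m → trans (sym (ℚ.*-assoc (ℕ→ℚ 2 ^ j) (prefactor j m) (T k))) (term k≤m)) ⟩
  chebyshevFibonacciCoeff j m ∎
  where
  open ≡-Reasoning
  T : ℕ → ℚ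
  T = hyp2F1Term m (- ℕ→ℚ j + ℕ→ℚ m - 1ℚ) (- ℕ→ℚ j) (- ¼)
  term : ∀ {k} → k ≤ m → ℕ→ℚ 2 ^ j * prefactor j m * T k
    ≡ chebyshevCoeff j k * ℕ→ℚ 2 ^ (j ∸ 2 ℕ.* k) * fibonacciCoeff (j ∸ 2 ℕ.* k) (m ∸ k)
  term {k} k≤m = hyp2F1Term≡chebyshevFibonacciSummand m≡k+i j≡2m+r j≡k+d d≡k+n n≡2i+r
    where
    i = m ∸ k
    r = j ∸ 2 ℕ.* m
    d = j ∸ k
    n = j ∸ 2 ℕ.* k
    m≡k+i : m ≡ k ℕ.+ i
    m≡k+i = sym (m+[n∸m]≡n k≤m)
    j≡2m+r : j ≡ m ℕ.+ m ℕ.+ r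
    j≡2m+r = trans (sym (m+[n∸m]≡n 2m≤j)) (cong (ℕ._+ r) (2*n≡n+n m))
    j≡k+[k+n′] : j ≡ k ℕ.+ (k ℕ.+ (i ℕ.+ i ℕ.+ r))
    j≡k+[k+n′] = trans j≡2m+r (trans (cong (λ m → m ℕ.+ m ℕ.+ r) m≡k+i) (shape k i r))
      where shape : ∀ k i r → k ℕ.+ i ℕ.+ (k ℕ.+ i) ℕ.+ r ≡ k ℕ.+ (k ℕ.+ (i ℕ.+ i ℕ.+ r))
            shape = ℕ-Solver.solve-∀
    d≡k+n′ : d ≡ k ℕ.+ (i ℕ.+ i ℕ.+ r)
    d≡k+n′ = trans (cong (_∸ k) j≡k+[k+n′]) (m+n∸m≡n k (k ℕ.+ (i ℕ.+ i ℕ.+ r)))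
    j≡k+d : j ≡ k ℕ.+ d
    j≡k+d = trans j≡k+[k+n′] (cong (k ℕ.+_) (sym d≡k+n′))
    n≡2i+r : n ≡ i ℕ.+ i ℕ.+ r
    n≡2i+r = begin
      j ∸ 2 ℕ.* k                            ≡⟨ cong (j ∸_) (2*n≡n+n k) ⟩
      j ∸ (k ℕ.+ k)                          ≡⟨ ℕ.∸-+-assoc j k k ⟨
      d ∸ k                                  ≡⟨ cong (_∸ k) d≡k+n′ ⟩
      k ℕ.+ (i ℕ.+ i ℕ.+ r) ∸ k              ≡⟨ m+n∸m≡n k (i ℕ.+ i ℕ.+ r) ⟩
      i ℕ.+ i ℕ.+ r                          ∎
    d≡k+n : d ≡ k ℕ.+ n
    d≡k+n = trans d≡k+n′ (cong (k ℕ.+_) (sym n≡2i+r))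

theorem2 : (j : ℕ) → j ≥ 1 → (x : ℚ) →
    U j x ≡ (ℕ→ℚ 2 ^ j) * sumTo ⌊ j /2⌋ (rhsTerm j x)
-- The identity also holds for j = 0.
theorem2 j _ x = begin
  U j x
    ≡⟨ U-fibonacci-expansion j x ⟩
  sumTo ⌊ j /2⌋ (λ m → chebyshevFibonacciCoeff j m * F (suc j ∸ 2 ℕ.* m) x)
    ≡⟨ sumTo-cong ⌊ j /2⌋ (λ m m≤⌊j/2⌋ → sym (summand m (m≤⌊n/2⌋⇒2*m≤n m≤⌊j/2⌋))) ⟩
  sumTo ⌊ j /2⌋ (λ m → ℕ→ℚ 2 ^ j * rhsTerm j x m)
    ≡⟨ *-distribˡ-sumTo ⌊ j /2⌋ (ℕ→ℚ 2 ^ j) (rhsTerm j x) ⟨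
  ℕ→ℚ 2 ^ j * sumTo ⌊ j /2⌋ (rhsTerm j x) ∎
  where
  open ≡-Reasoning
  summand : ∀ m → 2 ℕ.* m ≤ j →
    ℕ→ℚ 2 ^ j * rhsTerm j x m ≡ chebyshevFibonacciCoeff j m * F (suc j ∸ 2 ℕ.* m) x
  summand m 2m≤j =
    trans (sym (ℚ.*-assoc (ℕ→ℚ 2 ^ j) (prefactor j m * hyp2F1 m (- ℕ→ℚ j + ℕ→ℚ m - 1ℚ) (- ℕ→ℚ j) (- ¼))
                          (F ((j ∸ 2 ℕ.* m) ℕ.+ 1) x)))
          (cong₂ (λ c i → c * F i x) (prefactor*hyp2F1≡chebyshevFibonacciCoeff {j} {m} 2m≤j)
                 (trans (ℕ.+-comm (j ∸ 2 ℕ.* m) 1) (sym (+-∸-assoc 1 2m≤j))))
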